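{- Let $G$ be a split graph with a partition $C,I$ of its vertices, where $C$ is a clique and $I$ is an independent set. Suppose there are no vertices $x,y\in I$ such that $|N(x)\setminus N(y)|\ge 2$ and $|N(y)\setminus N(x)|\ge 2$. Let $I_0$ be the set of vertices of $I$ of minimum degree (i.e., $x\in I_0$ iff $|N(x)|\le|N(y)|$ for all $y\in I$), and suppose that every two vertices in $I_0$ are twins. Let $u\in I_0$, let $a_1,a_2$ be two distinct vertices in $N(u)$, and let $v_1,v_2\in I$ be vertices such that $a_1\notin N(v_1)$ and $a_2\notin N(v_2)$. Then $|(N(v_1)\cap N(v_2))\setminus N(u)|\ge 2$.
   Context: $N(v)$ denotes the set of vertices adjacent to $v$ in $G$. Two vertices $x,y\in I$ are twins if $N(x)=N(y)$. A split graph is a graph whose vertex set can be partitioned into a clique and an independent set. -}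

module Defs where

open import Data.Nat using (ℕ; _≤_)
open import Data.Fin using (Fin)
open import Data.Fin.Subset using (Subset; _∈_; _∉_; _∩_; _─_; ∣_∣)
open import Data.Bool using (Bool; true; false)
open import Relation.Binary.PropositionalEquality using (_≡_)
open import Relation.Nullary using (¬_)

record Graph (n : ℕ) : Set where
  field
    N     : Fin n → Subset n
    sym   : ∀ x y → x ∈ N y → y ∈ N x
    irrefl : ∀ x → x ∉ N x
open Graph public

deg : ∀ {n} → Graph n → Fin n → ℕ
deg G v = ∣ N G v ∣

-- A split partition (C, I) of the vertex set: C is a clique, I = complement of C is independent.
-- The partition is encoded as the characteristic subset C; I is its complement.
record SplitPartition {n : ℕ} (G : Graph n) (C : Subset n) : Set where
  field
    clique      : ∀ x y → x ∈ C → y ∈ C → ¬ (x ≡ y) → y ∈ N G x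
    independent : ∀ x y → x ∉ C → y ∉ C → y ∉ N G x

MinDegI : ∀ {n} → Graph n → Subset n → Fin n → Set
MinDegI G C x = x ∉ C × (∀ y → y ∉ C → deg G x ≤ deg G y)
  where open import Data.Product using (_×_)

Twins : ∀ {n} → Graph n → Fin n → Fin n → Set
Twins G x y = N G x ≡ N G y

-- A vertex v of I missing a neighbour a of u has larger degree than u (otherwise v would be of
-- minimum degree and hence a twin of u), so |N(v) ∖ N(u)| > |N(u) ∖ N(v)| ≥ 1. The no-crossing
-- hypothesis applied to u and v then forces N(u) ∖ N(v) = {a}. Now say |N(v₁) ∖ N(v₂)| ≤ 1 (by
-- no-crossing, up to symmetry). Its only element is a₂, which lies in N(u); hence every vertex of
-- N(v₁) ∖ N(u) is also in N(v₂), and this set already has at least two elements.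
module Submission where

open import Defs
open import Data.Nat using (ℕ; _≤_; _≥_; _<_; suc; z≤n; s≤s; _+_)
open import Data.Nat.Properties using (≤-trans; <⇒≱; ≰⇒>; _≤?_; +-suc; +-cancelˡ-<)
open import Data.Fin using (Fin)
open import Data.Fin.Subset using (Subset; _∈_; _∉_; _∩_; _─_; ∣_∣; _⊆_; inside; outside)
open import Data.Fin.Subset.Properties
  using (_∈?_; p⊆q⇒∣p∣≤∣q∣; x∈p∩q⁺; x∈p∧x∉q⇒x∈p─q; x∈p∧x≢y⇒x∈p-y; p─q⊆p; x∈p⇒∣p-x∣<∣p∣; ∩-comm)
open import Data.Vec using (_∷_; []; here; there)
open import Data.Product using (_×_; _,_; proj₁; proj₂)
open import Data.Sum using (_⊎_; inj₁; inj₂)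
open import Relation.Binary.PropositionalEquality
  using (_≡_; _≢_; refl; trans; cong; subst; subst₂) renaming (sym to ≡-sym)
open import Function using (_∘_)
open import Relation.Nullary using (¬_; yes; no; contradiction)
open import Relation.Nullary.Decidable using (decidable-stable)

¬[k≤m×k≤n]⇒m<k⊎n<k : ∀ {k m n} → ¬ (k ≤ m × k ≤ n) → m < k ⊎ n < k
¬[k≤m×k≤n]⇒m<k⊎n<k {k} {m} {n} ¬both with k ≤? m | k ≤? n
... | no k≰m  | _       = inj₁ (≰⇒> k≰m)
... | _       | no k≰n  = inj₂ (≰⇒> k≰n)
... | yes k≤m | yes k≤n = contradiction (k≤m , k≤n) ¬both

x∈p─q⇒x∉q : ∀ {n} {x : Fin n} (p q : Subset n) → x ∈ p ─ q → x ∉ q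
x∈p─q⇒x∉q (inside ∷ p) (outside ∷ q) here       ()
x∈p─q⇒x∉q (_ ∷ p)      (_ ∷ q)       (there x∈) (there x∈q) = x∈p─q⇒x∉q p q x∈ x∈q

∣p∣≡∣p∩q∣+∣p─q∣ : ∀ {n} (p q : Subset n) → ∣ p ∣ ≡ ∣ p ∩ q ∣ + ∣ p ─ q ∣
∣p∣≡∣p∩q∣+∣p─q∣ []            []            = refl
∣p∣≡∣p∩q∣+∣p─q∣ (inside  ∷ p) (inside  ∷ q) = cong suc (∣p∣≡∣p∩q∣+∣p─q∣ p q)
∣p∣≡∣p∩q∣+∣p─q∣ (inside  ∷ p) (outside ∷ q) = trans (cong suc (∣p∣≡∣p∩q∣+∣p─q∣ p q)) (≡-sym (+-suc _ _))
∣p∣≡∣p∩q∣+∣p─q∣ (outside ∷ p) (inside  ∷ q) = ∣p∣≡∣p∩q∣+∣p─q∣ p q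
∣p∣≡∣p∩q∣+∣p─q∣ (outside ∷ p) (outside ∷ q) = ∣p∣≡∣p∩q∣+∣p─q∣ p q

∣p∣<∣q∣⇒∣p─q∣<∣q─p∣ : ∀ {n} (p q : Subset n) → ∣ p ∣ < ∣ q ∣ → ∣ p ─ q ∣ < ∣ q ─ p ∣
∣p∣<∣q∣⇒∣p─q∣<∣q─p∣ p q = +-cancelˡ-< ∣ p ∩ q ∣ _ _ ∘ subst₂ _<_ ∣p∣≡ ∣q∣≡
  where
    ∣p∣≡ : ∣ p ∣ ≡ ∣ p ∩ q ∣ + ∣ p ─ q ∣
    ∣p∣≡ = ∣p∣≡∣p∩q∣+∣p─q∣ p q
    ∣q∣≡ : ∣ q ∣ ≡ ∣ p ∩ q ∣ + ∣ q ─ p ∣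
    ∣q∣≡ = trans (∣p∣≡∣p∩q∣+∣p─q∣ q p) (cong (λ r → ∣ r ∣ + ∣ q ─ p ∣) (∩-comm q p))

x∈p⇒0<∣p∣ : ∀ {n} {x : Fin n} {p : Subset n} → x ∈ p → 0 < ∣ p ∣
x∈p⇒0<∣p∣ x∈p = ≤-trans (s≤s z≤n) (x∈p⇒∣p-x∣<∣p∣ x∈p)

x∈p∧y∈p∧x≢y⇒2≤∣p∣ : ∀ {n} {x y : Fin n} {p : Subset n} → x ∈ p → y ∈ p → x ≢ y → 2 ≤ ∣ p ∣
x∈p∧y∈p∧x≢y⇒2≤∣p∣ x∈p y∈p x≢y =
  ≤-trans (s≤s (x∈p⇒0<∣p∣ (x∈p∧x≢y⇒x∈p-y y∈p (x≢y ∘ ≡-sym)))) (x∈p⇒∣p-x∣<∣p∣ x∈p)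

∣p─q∣<2⇒p─r⊆p∩q─r : ∀ {n} {a : Fin n} (p q r : Subset n) →
  ∣ p ─ q ∣ < 2 → a ∈ p ─ q → a ∈ r → p ─ r ⊆ (p ∩ q) ─ r
∣p─q∣<2⇒p─r⊆p∩q─r p q r ∣p─q∣<2 a∈p─q a∈r {x} x∈p─r = x∈p∧x∉q⇒x∈p─q (x∈p∩q⁺ (x∈p , x∈q)) x∉r
  where
    x∈p : x ∈ p
    x∈p = p─q⊆p p r x∈p─r
    x∉r : x ∉ r
    x∉r = x∈p─q⇒x∉q p r x∈p─r
    x∈q : x ∈ q
    x∈q = decidable-stable (x ∈? q) λ x∉q →
      <⇒≱ ∣p─q∣<2 (x∈p∧y∈p∧x≢y⇒2≤∣p∣ (x∈p∧x∉q⇒x∈p─q x∈p x∉q) a∈p─q λ { refl → x∉r a∈r })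

module _ {n : ℕ} (G : Graph n) (C : Subset n)
         (minTwins : ∀ x y → MinDegI G C x → MinDegI G C y → Twins G x y)
         {u : Fin n} (u-min : MinDegI G C u) where

  Nu≢Nv⇒deg<deg : ∀ {v} → v ∉ C → N G u ≢ N G v → deg G u < deg G v
  Nu≢Nv⇒deg<deg {v} v∉C Nu≢Nv with deg G v ≤? deg G u
  ... | yes dv≤du = contradiction (minTwins u v u-min v-min) Nu≢Nv
    where
      v-min : MinDegI G C v
      v-min = v∉C , λ y y∉C → ≤-trans dv≤du (proj₂ u-min y y∉C)
  ... | no dv≰du = ≰⇒> dv≰du

  2≤∣Nv─Nu∣ : ∀ {v a} → v ∉ C → a ∈ N G u → a ∉ N G v → 2 ≤ ∣ N G v ─ N G u ∣
  2≤∣Nv─Nu∣ {v} v∉C a∈Nu a∉Nv =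
    ≤-trans (s≤s (x∈p⇒0<∣p∣ (x∈p∧x∉q⇒x∈p─q a∈Nu a∉Nv)))
            (∣p∣<∣q∣⇒∣p─q∣<∣q─p∣ (N G u) (N G v) (Nu≢Nv⇒deg<deg v∉C Nu≢Nv))
    where
      Nu≢Nv : N G u ≢ N G v
      Nu≢Nv Nu≡Nv = a∉Nv (subst (_ ∈_) Nu≡Nv a∈Nu)

  module _ (noCrossing : ∀ x y → x ∉ C → y ∉ C →
                           ¬ ((∣ N G x ─ N G y ∣ ≥ 2) × (∣ N G y ─ N G x ∣ ≥ 2))) where

    missing-unique : ∀ {v a b} → v ∉ C → a ∈ N G u → a ∉ N G v → b ∈ N G u → b ≢ a → b ∈ N G v
    missing-unique {v} {b = b} v∉C a∈Nu a∉Nv b∈Nu b≢a = decidable-stable (b ∈? N G v) λ b∉Nv →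
      noCrossing v u v∉C (proj₁ u-min)
        ( 2≤∣Nv─Nu∣ v∉C a∈Nu a∉Nv
        , x∈p∧y∈p∧x≢y⇒2≤∣p∣ (x∈p∧x∉q⇒x∈p─q b∈Nu b∉Nv) (x∈p∧x∉q⇒x∈p─q a∈Nu a∉Nv) b≢a)

    2≤∣Nv∩Nw─Nu∣ : ∀ {v w a b} → v ∉ C → ∣ N G v ─ N G w ∣ < 2 →
      a ∈ N G u → b ∈ N G u → b ≢ a → a ∉ N G v → b ∉ N G w → 2 ≤ ∣ (N G v ∩ N G w) ─ N G u ∣
    2≤∣Nv∩Nw─Nu∣ {v} {w} {b = b} v∉C small a∈Nu b∈Nu b≢a a∉Nv b∉Nw =
      ≤-trans (2≤∣Nv─Nu∣ v∉C a∈Nu a∉Nv)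
              (p⊆q⇒∣p∣≤∣q∣ (∣p─q∣<2⇒p─r⊆p∩q─r (N G v) (N G w) (N G u) small b∈Nv─Nw b∈Nu))
      where
        b∈Nv─Nw : b ∈ N G v ─ N G w
        b∈Nv─Nw = x∈p∧x∉q⇒x∈p─q (missing-unique v∉C a∈Nu a∉Nv b∈Nu b≢a) b∉Nw

lemma3 : {n : ℕ} (G : Graph n) (C : Subset n) → SplitPartition G C →
    (∀ x y → x ∉ C → y ∉ C →
      ¬ ((∣ N G x ─ N G y ∣ ≥ 2) × (∣ N G y ─ N G x ∣ ≥ 2))) →
    (∀ x y → MinDegI G C x → MinDegI G C y → Twins G x y) →
    (u : Fin n) → MinDegI G C u →
    (a₁ a₂ : Fin n) → ¬ (a₁ ≡ a₂) → a₁ ∈ N G u → a₂ ∈ N G u →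
    (v₁ v₂ : Fin n) → v₁ ∉ C → v₂ ∉ C → a₁ ∉ N G v₁ → a₂ ∉ N G v₂ →
    ∣ (N G v₁ ∩ N G v₂) ─ N G u ∣ ≥ 2
lemma3 G C _ noCrossing minTwins u u-min a₁ a₂ a₁≢a₂ a₁∈Nu a₂∈Nu v₁ v₂ v₁∉C v₂∉C a₁∉Nv₁ a₂∉Nv₂
  with ¬[k≤m×k≤n]⇒m<k⊎n<k (noCrossing v₁ v₂ v₁∉C v₂∉C)
... | inj₁ small =
  2≤∣Nv∩Nw─Nu∣ G C minTwins u-min noCrossing v₁∉C small a₁∈Nu a₂∈Nu (a₁≢a₂ ∘ ≡-sym) a₁∉Nv₁ a₂∉Nv₂
... | inj₂ small =
  subst (λ s → 2 ≤ ∣ s ─ N G u ∣) (∩-comm (N G v₂) (N G v₁))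
    (2≤∣Nv∩Nw─Nu∣ G C minTwins u-min noCrossing v₂∉C small a₂∈Nu a₁∈Nu a₁≢a₂ a₂∉Nv₂ a₁∉Nv₁)
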